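{- Let $i\in\{1,2\}$ and let $\mathcal F$ be a dense $3$-graph with $n\ge 6-i$ vertices. Then there are edges $e_1,e_2\in\mathcal F$ with $|e_1\cap e_2|=i$.
   Context: A $3$-graph is a set of $3$-element subsets (edges) of a finite vertex set. For a $3$-graph $G$ on $[n]$ and $\vec x$ in $\Delta_n=\{\vec x\in[0,\infty)^n:\sum x_i=1\}$, $\lambda(G,\vec x)=\sum_{e\in G}\prod_{i\in e}x_i$ and the Lagrangian is $\lambda(G)=\max_{\vec x\in\Delta_n}\lambda(G,\vec x)$. A $3$-graph $G$ is dense if $\lambda(G')<\lambda(G)$ for every subgraph $G'$ of $G$ with $|V(G')|<|V(G)|$. -}

module Defs where

open import Data.Nat using (ℕ; zero; suc; _<_)
open import Data.Bool using (Bool; true; false; if_then_else_)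
open import Data.Fin using (Fin; zero; suc)
open import Data.Vec using (Vec; []; _∷_)
open import Data.Fin.Subset as Sub using (Subset; ∣_∣; ⊤; _⊆_; _∉_)
open import Data.Rational using (ℚ; 0ℚ; 1ℚ; _+_; _*_) renaming (_≤_ to _≤ℚ_; _<_ to _<ℚ_)
open import Data.List using (List; []; _∷_)
open import Data.List.Relation.Unary.All using (All)
open import Data.List.Relation.Unary.Unique.Propositional using (Unique)
open import Data.List.Membership.Propositional using (_∈_)
open import Data.Product using (Σ; _×_; ∃)
open import Relation.Binary.PropositionalEquality using (_≡_)

Is3Graph : {n : ℕ} → List (Subset n) → Set
Is3Graph G = Unique G × All (λ e → ∣ e ∣ ≡ 3) G

sumF : {n : ℕ} → (Fin n → ℚ) → ℚ
sumF {zero}  x = 0ℚ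
sumF {suc n} x = x zero + sumF (λ i → x (suc i))

prodOn : {n : ℕ} → Subset n → (Fin n → ℚ) → ℚ
prodOn []      x = 1ℚ
prodOn (b ∷ e) x = (if b then x zero else 1ℚ) * prodOn e (λ i → x (suc i))

lam : {n : ℕ} → List (Subset n) → (Fin n → ℚ) → ℚ
lam []      x = 0ℚ
lam (e ∷ G) x = prodOn e x + lam G x

InSimplex : {n : ℕ} → Subset n → (Fin n → ℚ) → Set
InSimplex S y = (∀ i → 0ℚ ≤ℚ y i) × (∀ i → i ∉ S → y i ≡ 0ℚ) × (sumF y ≡ 1ℚ)

-- Since λ(H) = sup of λ(H, ·) over rational points of the simplex
-- (continuity + density of ℚ), λ(G') < λ(G) holds iff some rational
-- x ∈ Δ_n and rational ε > 0 satisfy λ(G', y) + ε ≤ λ(G, x) for all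
-- rational y ∈ Δ_S.
LagLess : {n : ℕ} → List (Subset n) → Subset n → List (Subset n) → Set
LagLess G' S G =
  Σ (Fin _ → ℚ) λ x → InSimplex ⊤ x ×
  Σ ℚ λ ε → (0ℚ <ℚ ε) ×
  (∀ y → InSimplex S y → (lam G' y + ε) ≤ℚ lam G x)

IsSubgraphOn : {n : ℕ} → List (Subset n) → Subset n → List (Subset n) → Set
IsSubgraphOn G' S G = Unique G' × All (λ e → (e ∈ G) × (e ⊆ S)) G'

Dense : {n : ℕ} → List (Subset n) → Set
Dense {n} G = ∀ (S : Subset n) (G' : List (Subset n)) →
  ∣ S ∣ < n → IsSubgraphOn G' S G → LagLess G' S G

-- Density forces every pair of vertices into a common edge: otherwise the weights of the two
-- vertices could be merged onto one of them without lowering the Lagrangian, so deleting one of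
-- them would not lower it either. For i = 1, an edge E₀, an edge E₂ through two vertices outside
-- E₀ and an edge E₁ through a vertex of E₀ and one of E₂ cannot pairwise meet in 0, 2 or 3
-- vertices only. For i = 2, if no two edges share exactly two vertices then F is linear, so every
-- link is a matching; a per-vertex AM-GM bound then gives λ(F) ≤ 1/27, the Lagrangian of a
-- single edge, contradicting density.
module Submission where

open import Defs
open import Agda.Builtin.FromNat using (Number; fromNat)
open import Algebra.Bundles using (CommutativeRing)
open import Data.Bool using (if_then_else_)
open import Data.Fin using (Fin; zero; suc)
open import Data.Fin.Properties using () renaming (_≟_ to _≟ᶠ_)
open import Data.Fin.Subset
  using (Subset; inside; outside; ⊤; ⊥; ∣_∣; _∩_; ∁; _─_; ⁅_⁆; _⊆_; Nonempty; Empty)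
  renaming (_∈_ to _∈ᵥ_; _∉_ to _∉ᵥ_)
open import Data.Fin.Subset.Properties
  using ( _∈?_; nonempty?; Empty-unique; ∉⊥; ∈⊤; ∣⊥∣≡0; ∣⊤∣≡n; drop-∷-⊆; ⊆-antisym; ∩-comm
        ; p─⊥≡p; p─q⊆p; p∩q⊆p; x∈⁅y⁆⇒x≡y; x∉⁅y⁆⇒x≢y; x∈p∩q⁻; x∈p∩q⁺; x∉p⇒x∈∁p; x∈∁p⇒x∉p
        ; x∈p∧x≢y⇒x∈p-y; x∈p∧x∉q⇒x∈p─q; p⊂q⇒∣p∣<∣q∣; p⊆q⇒∣p∣≤∣q∣; x∈p⇒∣p-x∣<∣p∣
        ; ∣∁p∣≡n∸∣p∣; ∣p∩q∣≤∣p∣ )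
open import Data.List using (List; []; _∷_; filter)
open import Data.List.Membership.Propositional.Properties using (∈-filter⁻)
open import Data.List.Relation.Unary.All as All using (All; []; _∷_)
open import Data.List.Relation.Unary.All.Properties using (¬Any⇒All¬)
open import Data.List.Relation.Unary.Any using (Any; any?; here; there)
open import Data.List.Relation.Unary.AllPairs as AllPairs using (AllPairs; []; _∷_)
open import Data.List.Relation.Unary.Unique.Propositional using (Unique)
import Data.List.Relation.Unary.Unique.Propositional.Properties as Unique
open import Data.List.Membership.Propositional using (_∈_; find; lose)
open import Data.Nat as ℕ using (ℕ; zero; suc)
import Data.Nat.Properties as ℕP
import Data.Nat.Literals
open import Data.Product using (Σ; _×_; _,_; ∃; ∃₂; proj₁; proj₂)
open import Data.Rational using (ℚ; 0ℚ; 1ℚ; _+_; _*_; _-_; -_; 1/_; _≤_; _<_; nonNegative; positive)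
import Data.Rational.Literals
open import Data.Rational.Properties
open import Data.Sum using (_⊎_; inj₁; inj₂; [_,_]′)
open import Data.Unit using (tt)
open import Data.Vec using ([]; _∷_; lookup; here; there)
open import Data.Vec.Functional using (updateAt)
open import Data.Vec.Functional.Properties using (updateAt-updates; updateAt-minimal)
open import Data.Vec.Properties using ([]=⇒lookup)
open import Function using (_∘_; const)
open import Level using (0ℓ)
open import Relation.Binary.PropositionalEquality
open import Relation.Nullary using (¬_; ¬?; yes; no; contradiction)
open import Relation.Nullary.Decidable using (Dec; dec⇒maybe; decidable-stable; map′; _×-dec_)
import Tactic.RingSolver as RingSolver
import Tactic.RingSolver.Core.AlmostCommutativeRing as ACR

instance
  ℕ-number : Number ℕ
  ℕ-number = Data.Nat.Literals.number

  ℚ-number : Number ℚ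
  ℚ-number = Data.Rational.Literals.number

ℚ-ring : ACR.AlmostCommutativeRing 0ℓ 0ℓ
ℚ-ring = ACR.fromCommutativeRing +-*-commutativeRing (dec⇒maybe ∘ (0ℚ ≟_))

open RingSolver using (solve-∀)
open import Algebra.Properties.Group +-0-group using () renaming (∙-cancelʳ to +-cancelʳ)
open import Algebra.Properties.Semiring.Exp (CommutativeRing.semiring +-*-commutativeRing) using (_^_)
open import Algebra.Properties.Semiring.Mult (CommutativeRing.semiring +-*-commutativeRing)
  using () renaming (_×_ to _·_)
open import Algebra.Properties.Semiring.Sum (CommutativeRing.semiring +-*-commutativeRing)
  using (sum; sum-syntax; ∑-distrib-+; *-distribˡ-sum; sum-cong-≗; sum-replicate-zero)

0≤p*q : ∀ {p q} → 0ℚ ≤ p → 0ℚ ≤ q → 0ℚ ≤ p * q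
0≤p*q {p} {q} 0≤p 0≤q = nonNegative⁻¹ (p * q)
  {{nonNeg*nonNeg⇒nonNeg p {{nonNegative 0≤p}} q {{nonNegative 0≤q}}}}

0≤p+q : ∀ {p q} → 0ℚ ≤ p → 0ℚ ≤ q → 0ℚ ≤ p + q
0≤p+q = +-mono-≤

0≤q-p : ∀ {p q} → p ≤ q → 0ℚ ≤ q - p
0≤q-p {p} {q} p≤q = subst (_≤ q - p) (+-inverseʳ p) (+-monoˡ-≤ (- p) p≤q)

0≤p*p : ∀ p → 0ℚ ≤ p * p
0≤p*p p with ≤-total 0ℚ p
... | inj₁ 0≤p = 0≤p*q 0≤p 0≤p
... | inj₂ p≤0 = subst (0ℚ ≤_) (-p*-p≡p*p p) (0≤p*q (0≤q-p p≤0) (0≤q-p p≤0))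
  where
  -p*-p≡p*p : ∀ p → (0ℚ - p) * (0ℚ - p) ≡ p * p
  -p*-p≡p*p = solve-∀ ℚ-ring

p≤p+q : ∀ {p q} → 0ℚ ≤ q → p ≤ p + q
p≤p+q {p} {q} 0≤q = subst (_≤ p + q) (+-identityʳ p) (+-monoʳ-≤ p 0≤q)

*-monoˡ-≤-0≤ : ∀ {r p q} → 0ℚ ≤ r → p ≤ q → r * p ≤ r * q
*-monoˡ-≤-0≤ {r} 0≤r = *-monoˡ-≤-nonNeg r {{nonNegative 0≤r}}

0<p*q : ∀ {p q} → 0ℚ < p → 0ℚ < q → 0ℚ < p * q
0<p*q {p} {q} 0<p 0<q = positive⁻¹ (p * q) {{pos*pos⇒pos p {{positive 0<p}} q {{positive 0<q}}}}

p<p+q : ∀ {p q} → 0ℚ < q → p < p + q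
p<p+q {p} {q} 0<q = subst (_< p + q) (+-identityʳ p) (+-monoʳ-< p 0<q)

≤-by-gap : ∀ {p q} d → 0ℚ ≤ d → q ≡ p + d → p ≤ q
≤-by-gap {p} d 0≤d q≡p+d = subst (p ≤_) (sym q≡p+d) (p≤p+q 0≤d)

≤-weighted-average : ∀ {a b p q r} → 0ℚ ≤ a → 0ℚ ≤ b → 0ℚ < a + b →
  (a + b) * r ≡ a * p + b * q → r ≤ p ⊎ r ≤ q
≤-weighted-average {a} {b} {p} {q} {r} 0≤a 0≤b 0<a+b average with ≤-total q p
... | inj₁ q≤p = inj₁ (*-cancelˡ-≤-pos (a + b) {{positive 0<a+b}} (begin
  (a + b) * r    ≡⟨ average ⟩
  a * p + b * q  ≤⟨ +-monoʳ-≤ (a * p) (*-monoˡ-≤-0≤ 0≤b q≤p) ⟩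
  a * p + b * p  ≡⟨ *-distribʳ-+ p a b ⟨
  (a + b) * p    ∎))
  where open ≤-Reasoning
... | inj₂ p≤q = inj₂ (*-cancelˡ-≤-pos (a + b) {{positive 0<a+b}} (begin
  (a + b) * r    ≡⟨ average ⟩
  a * p + b * q  ≤⟨ +-monoˡ-≤ (b * q) (*-monoˡ-≤-0≤ 0≤a p≤q) ⟩
  a * q + b * q  ≡⟨ *-distribʳ-+ q a b ⟨
  (a + b) * q    ∎))
  where open ≤-Reasoning

sumF≡sum : ∀ {n} (x : Fin n → ℚ) → sumF x ≡ sum x
sumF≡sum {zero}  x = refl
sumF≡sum {suc n} x = cong (x zero +_) (sumF≡sum (x ∘ suc))

∑-mono-≤ : ∀ {n} {f g : Fin n → ℚ} → (∀ i → f i ≤ g i) → sum f ≤ sum g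
∑-mono-≤ {zero}  f≤g = ≤-refl
∑-mono-≤ {suc n} f≤g = +-mono-≤ (f≤g zero) (∑-mono-≤ (f≤g ∘ suc))

∑-updateAt : ∀ {n} (x : Fin n → ℚ) i (f : ℚ → ℚ) → sum (updateAt x i f) + x i ≡ sum x + f (x i)
∑-updateAt x zero    f = swap (f (x zero)) (sum (x ∘ suc)) (x zero)
  where
  swap : ∀ a s b → (a + s) + b ≡ (b + s) + a
  swap = solve-∀ ℚ-ring
∑-updateAt x (suc i) f = begin
  (x zero + sum (updateAt (x ∘ suc) i f)) + x (suc i)  ≡⟨ +-assoc (x zero) _ _ ⟩
  x zero + (sum (updateAt (x ∘ suc) i f) + x (suc i))  ≡⟨ cong (x zero +_) (∑-updateAt (x ∘ suc) i f) ⟩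
  x zero + (sum (x ∘ suc) + f (x (suc i)))             ≡⟨ +-assoc (x zero) _ _ ⟨
  (x zero + sum (x ∘ suc)) + f (x (suc i))             ∎
  where open ≡-Reasoning

∑ₗ : {A : Set} → List A → (A → ℚ) → ℚ
∑ₗ []      f = 0ℚ
∑ₗ (a ∷ L) f = f a + ∑ₗ L f

lam≡∑ₗ : ∀ {n} (F : List (Subset n)) x → lam F x ≡ ∑ₗ F (λ e → prodOn e x)
lam≡∑ₗ []      x = refl
lam≡∑ₗ (e ∷ F) x = cong (prodOn e x +_) (lam≡∑ₗ F x)

∑ₗ-congᴬ : {A : Set} {f g : A → ℚ} (L : List A) → All (λ a → f a ≡ g a) L → ∑ₗ L f ≡ ∑ₗ L g
∑ₗ-congᴬ []      []           = refl
∑ₗ-congᴬ (a ∷ L) (fa≡ga ∷ eq) = cong₂ _+_ fa≡ga (∑ₗ-congᴬ L eq)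

∑ₗ-cong : {A : Set} {f g : A → ℚ} (L : List A) → (∀ a → f a ≡ g a) → ∑ₗ L f ≡ ∑ₗ L g
∑ₗ-cong L f≗g = ∑ₗ-congᴬ L (All.universal f≗g L)

*-distribˡ-∑ₗ : ∀ {A : Set} c (f : A → ℚ) (L : List A) → c * ∑ₗ L f ≡ ∑ₗ L (λ a → c * f a)
*-distribˡ-∑ₗ c f []      = *-zeroʳ c
*-distribˡ-∑ₗ c f (a ∷ L) = trans (*-distribˡ-+ c (f a) _) (cong (c * f a +_) (*-distribˡ-∑ₗ c f L))

∑-∑ₗ-comm : ∀ {n} {A : Set} (g : Fin n → A → ℚ) (L : List A) →
  ∑[ v < n ] ∑ₗ L (g v) ≡ ∑ₗ L (λ a → ∑[ v < n ] g v a)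
∑-∑ₗ-comm {n} g []      = sum-replicate-zero n
∑-∑ₗ-comm     g (a ∷ L) =
  trans (∑-distrib-+ (λ v → g v a) (λ v → ∑ₗ L (g v))) (cong (sum (λ v → g v a) +_) (∑-∑ₗ-comm g L))

∑ₗ-nonNeg : {A : Set} {f : A → ℚ} (L : List A) → All (λ a → 0ℚ ≤ f a) L → 0ℚ ≤ ∑ₗ L f
∑ₗ-nonNeg []      []            = ≤-refl
∑ₗ-nonNeg (a ∷ L) (0≤fa ∷ 0≤fL) = 0≤p+q 0≤fa (∑ₗ-nonNeg L 0≤fL)

-- (Σ g)² ≥ Σ g² because the cross terms are nonnegative.
∑ₗ-square-bound : {A : Set} {f g : A → ℚ} (L : List A) → All (λ a → 4 * f a ≤ g a * g a × 0ℚ ≤ g a) L →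
  4 * ∑ₗ L f ≤ ∑ₗ L g * ∑ₗ L g
∑ₗ-square-bound [] [] = ≤-refl
∑ₗ-square-bound {f = f} {g} (a ∷ L) ((4fa≤ga² , 0≤ga) ∷ bounds) = begin
  4 * (f a + F)                   ≡⟨ *-distribˡ-+ 4 (f a) F ⟩
  4 * f a + 4 * F                 ≤⟨ +-mono-≤ 4fa≤ga² (∑ₗ-square-bound L bounds) ⟩
  g a * g a + G * G               ≤⟨ ≤-by-gap _ cross-terms (square (g a) G) ⟩
  (g a + G) * (g a + G)           ∎
  where
  open ≤-Reasoning
  F G : ℚ
  F = ∑ₗ L f
  G = ∑ₗ L g
  0≤G : 0ℚ ≤ G
  0≤G = ∑ₗ-nonNeg L (All.map proj₂ bounds)
  cross-terms : 0ℚ ≤ 2 * (g a * G)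
  cross-terms = 0≤p*q (nonNegative⁻¹ 2) (0≤p*q 0≤ga 0≤G)
  square : ∀ p q → (p + q) * (p + q) ≡ (p * p + q * q) + 2 * (p * q)
  square = solve-∀ ℚ-ring

1≤m∧m≢1⇒2≤m : ∀ {m} → 1 ℕ.≤ m → m ≢ 1 → 2 ℕ.≤ m
1≤m∧m≢1⇒2≤m 1≤m m≢1 = ℕP.≤∧≢⇒< 1≤m (m≢1 ∘ sym)

x∈p─q⇒x∉q : ∀ {n} {p q : Subset n} {x} → x ∈ᵥ p ─ q → x ∉ᵥ q
x∈p─q⇒x∉q {p = inside ∷ p} {outside ∷ q} here           ()
x∈p─q⇒x∉q {p = _      ∷ p} {_       ∷ q} (there x∈p─q) (there x∈q) = x∈p─q⇒x∉q x∈p─q x∈q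

x∈p-y⇒x∈p×x≢y : ∀ {n} {p : Subset n} {x y} → x ∈ᵥ p ─ ⁅ y ⁆ → x ∈ᵥ p × x ≢ y
x∈p-y⇒x∈p×x≢y {p = p} {y = y} x∈p-y = p─q⊆p p ⁅ y ⁆ x∈p-y , x∉⁅y⁆⇒x≢y (x∈p─q⇒x∉q x∈p-y)

x∈p⇒suc∣p-x∣≡∣p∣ : ∀ {n} {p : Subset n} {x} → x ∈ᵥ p → suc ∣ p ─ ⁅ x ⁆ ∣ ≡ ∣ p ∣
x∈p⇒suc∣p-x∣≡∣p∣ {p = inside  ∷ p} here        = cong (suc ∘ ∣_∣) (p─⊥≡p p)
x∈p⇒suc∣p-x∣≡∣p∣ {p = inside  ∷ p} (there x∈p) = cong suc (x∈p⇒suc∣p-x∣≡∣p∣ x∈p)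
x∈p⇒suc∣p-x∣≡∣p∣ {p = outside ∷ p} (there x∈p) = x∈p⇒suc∣p-x∣≡∣p∣ x∈p

∉⇒lookup≡outside : ∀ {n} {p : Subset n} {v} → v ∉ᵥ p → lookup p v ≡ outside
∉⇒lookup≡outside {p = inside  ∷ p} {zero}  v∉p = contradiction here v∉p
∉⇒lookup≡outside {p = outside ∷ p} {zero}  v∉p = refl
∉⇒lookup≡outside {p = _       ∷ p} {suc v} v∉p = ∉⇒lookup≡outside (v∉p ∘ there)

x∈p⇒1≤∣p∣ : ∀ {n} {p : Subset n} {x} → x ∈ᵥ p → 1 ℕ.≤ ∣ p ∣
x∈p⇒1≤∣p∣ x∈p = subst (1 ℕ.≤_) (x∈p⇒suc∣p-x∣≡∣p∣ x∈p) (ℕ.s≤s ℕ.z≤n)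

x,y∈p⇒2≤∣p∣ : ∀ {n} {p : Subset n} {x y} → x ∈ᵥ p → y ∈ᵥ p → x ≢ y → 2 ℕ.≤ ∣ p ∣
x,y∈p⇒2≤∣p∣ x∈p y∈p x≢y =
  subst (2 ℕ.≤_) (x∈p⇒suc∣p-x∣≡∣p∣ x∈p) (ℕ.s≤s (x∈p⇒1≤∣p∣ (x∈p∧x≢y⇒x∈p-y y∈p (x≢y ∘ sym))))

1≤∣p∣⇒Nonempty : ∀ {n} {p : Subset n} → 1 ℕ.≤ ∣ p ∣ → Nonempty p
1≤∣p∣⇒Nonempty {n} {p} 1≤∣p∣ with nonempty? p
... | yes nonempty = nonempty
... | no  empty    = contradiction (trans (cong ∣_∣ (Empty-unique empty)) (∣⊥∣≡0 n)) (ℕP.m<n⇒n≢0 1≤∣p∣)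

2≤∣p∣⇒two-elements : ∀ {n} {p : Subset n} → 2 ℕ.≤ ∣ p ∣ → ∃₂ λ x y → x ∈ᵥ p × y ∈ᵥ p × x ≢ y
2≤∣p∣⇒two-elements {p = p} 2≤∣p∣ with 1≤∣p∣⇒Nonempty (ℕP.<⇒≤ 2≤∣p∣)
... | x , x∈p
  with 1≤∣p∣⇒Nonempty {p = p ─ ⁅ x ⁆} (ℕP.≤-pred (subst (2 ℕ.≤_) (sym (x∈p⇒suc∣p-x∣≡∣p∣ x∈p)) 2≤∣p∣))
... | y , y∈p-x = let y∈p , y≢x = x∈p-y⇒x∈p×x≢y y∈p-x in x , y , x∈p , y∈p , y≢x ∘ sym

∣p∩q∣+∣p∩∁q∣≡∣p∣ : ∀ {n} (p q : Subset n) → ∣ p ∩ q ∣ ℕ.+ ∣ p ∩ ∁ q ∣ ≡ ∣ p ∣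
∣p∩q∣+∣p∩∁q∣≡∣p∣ []            []            = refl
∣p∩q∣+∣p∩∁q∣≡∣p∣ (inside  ∷ p) (inside  ∷ q) = cong suc (∣p∩q∣+∣p∩∁q∣≡∣p∣ p q)
∣p∩q∣+∣p∩∁q∣≡∣p∣ (inside  ∷ p) (outside ∷ q) = trans (ℕP.+-suc _ _) (cong suc (∣p∩q∣+∣p∩∁q∣≡∣p∣ p q))
∣p∩q∣+∣p∩∁q∣≡∣p∣ (outside ∷ p) (inside  ∷ q) = ∣p∩q∣+∣p∩∁q∣≡∣p∣ p q
∣p∩q∣+∣p∩∁q∣≡∣p∣ (outside ∷ p) (outside ∷ q) = ∣p∩q∣+∣p∩∁q∣≡∣p∣ p q

∣p∩q∣+∣p∩r∣≤∣p∣ : ∀ {n} (p : Subset n) {q r} → (∀ {w} → w ∈ᵥ r → w ∉ᵥ q) → ∣ p ∩ q ∣ ℕ.+ ∣ p ∩ r ∣ ℕ.≤ ∣ p ∣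
∣p∩q∣+∣p∩r∣≤∣p∣ p {q} {r} r∩q≡∅ =
  subst (∣ p ∩ q ∣ ℕ.+ ∣ p ∩ r ∣ ℕ.≤_) (∣p∩q∣+∣p∩∁q∣≡∣p∣ p q) (ℕP.+-monoʳ-≤ ∣ p ∩ q ∣ (p⊆q⇒∣p∣≤∣q∣ p∩r⊆p∩∁q))
  where
  p∩r⊆p∩∁q : p ∩ r ⊆ p ∩ ∁ q
  p∩r⊆p∩∁q w∈p∩r with x∈p∩q⁻ p r w∈p∩r
  ... | w∈p , w∈r = x∈p∩q⁺ (w∈p , x∉p⇒x∈∁p (r∩q≡∅ w∈r))

∣p∩q∣≡∣p∣⇒p⊆q : ∀ {n} {p q : Subset n} → ∣ p ∩ q ∣ ≡ ∣ p ∣ → p ⊆ q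
∣p∩q∣≡∣p∣⇒p⊆q {p = p} {q} ∣p∩q∣≡∣p∣ {x} x∈p with x ∈? q
... | yes x∈q = x∈q
... | no  x∉q =
  contradiction ∣p∩q∣≡∣p∣ (ℕP.<⇒≢ (p⊂q⇒∣p∣<∣q∣ (p∩q⊆p p q , x , x∈p , x∉q ∘ proj₂ ∘ x∈p∩q⁻ p q)))

m≤∣∁p∣ : ∀ {n} {p : Subset n} {k m} → ∣ p ∣ ≡ k → k ℕ.+ m ℕ.≤ n → m ℕ.≤ ∣ ∁ p ∣
m≤∣∁p∣ {n} {p} {k} {m} ∣p∣≡k k+m≤n = subst₂ ℕ._≤_ (ℕP.m+n∸m≡n k m)
  (sym (trans (∣∁p∣≡n∸∣p∣ p) (cong (n ℕ.∸_) ∣p∣≡k))) (ℕP.∸-monoˡ-≤ k k+m≤n)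

∣p∣≡0⇒p≡⊥ : ∀ {n} {p : Subset n} → ∣ p ∣ ≡ 0 → p ≡ ⊥
∣p∣≡0⇒p≡⊥ ∣p∣≡0 = Empty-unique λ (x , x∈p) → ℕP.m<n⇒n≢0 (x∈p⇒1≤∣p∣ x∈p) ∣p∣≡0

restrict : ∀ {n} → Subset n → (Fin n → ℚ) → Fin n → ℚ
restrict p f v = if lookup p v then f v else 0ℚ

restrict-∈ : ∀ {n} {p : Subset n} {v} f → v ∈ᵥ p → restrict p f v ≡ f v
restrict-∈ {v = v} f v∈p = cong (λ b → if b then f v else 0ℚ) ([]=⇒lookup v∈p)

restrict-∉ : ∀ {n} {p : Subset n} {v} f → v ∉ᵥ p → restrict p f v ≡ 0ℚ
restrict-∉ {v = v} f v∉p = cong (λ b → if b then f v else 0ℚ) (∉⇒lookup≡outside v∉p)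

restrict-nonNeg : ∀ {n} (p : Subset n) {f} → (∀ v → 0ℚ ≤ f v) → ∀ v → 0ℚ ≤ restrict p f v
restrict-nonNeg p {f} 0≤f v with v ∈? p
... | yes v∈p = subst (0ℚ ≤_) (sym (restrict-∈ {p = p} f v∈p)) (0≤f v)
... | no  v∉p = subst (0ℚ ≤_) (sym (restrict-∉ {p = p} f v∉p)) ≤-refl

x*restrict : ∀ {n} (p : Subset n) (x f : Fin n → ℚ) v → x v * restrict p f v ≡ restrict p (λ w → x w * f w) v
x*restrict p x f v with v ∈? p
... | yes v∈p = trans (cong (x v *_) (restrict-∈ {p = p} f v∈p))
                      (sym (restrict-∈ {p = p} (λ w → x w * f w) v∈p))
... | no  v∉p = trans (cong (x v *_) (restrict-∉ {p = p} f v∉p))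
                  (trans (*-zeroʳ (x v)) (sym (restrict-∉ {p = p} (λ w → x w * f w) v∉p)))

sumOn : ∀ {n} → Subset n → (Fin n → ℚ) → ℚ
sumOn []            f = 0ℚ
sumOn (inside  ∷ p) f = f zero + sumOn p (f ∘ suc)
sumOn (outside ∷ p) f = sumOn p (f ∘ suc)

sumOn≡∑restrict : ∀ {n} (p : Subset n) f → sumOn p f ≡ sum (restrict p f)
sumOn≡∑restrict []            f = refl
sumOn≡∑restrict (inside  ∷ p) f = cong (f zero +_) (sumOn≡∑restrict p (f ∘ suc))
sumOn≡∑restrict (outside ∷ p) f = trans (sumOn≡∑restrict p (f ∘ suc)) (sym (+-identityˡ _))

sumOn-⊤ : ∀ {n} (f : Fin n → ℚ) → sumOn ⊤ f ≡ sum f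
sumOn-⊤ {zero}  f = refl
sumOn-⊤ {suc n} f = cong (f zero +_) (sumOn-⊤ (f ∘ suc))

sumOn-⊥ : ∀ {n} (f : Fin n → ℚ) → sumOn ⊥ f ≡ 0ℚ
sumOn-⊥ {zero}  f = refl
sumOn-⊥ {suc n} f = sumOn-⊥ (f ∘ suc)

sumOn-cong : ∀ {n} (p : Subset n) {f g} → (∀ {v} → v ∈ᵥ p → f v ≡ g v) → sumOn p f ≡ sumOn p g
sumOn-cong []            f≗g = refl
sumOn-cong (inside  ∷ p) f≗g = cong₂ _+_ (f≗g here) (sumOn-cong p (f≗g ∘ there))
sumOn-cong (outside ∷ p) f≗g = sumOn-cong p (f≗g ∘ there)

sumOn-+ : ∀ {n} (p : Subset n) f g → sumOn p (λ v → f v + g v) ≡ sumOn p f + sumOn p g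
sumOn-+ []            f g = refl
sumOn-+ (inside  ∷ p) f g =
  trans (cong (f zero + g zero +_) (sumOn-+ p (f ∘ suc) (g ∘ suc)))
        (+-interchange (f zero) (g zero) (sumOn p (f ∘ suc)) (sumOn p (g ∘ suc)))
  where
  +-interchange : ∀ a b c d → (a + b) + (c + d) ≡ (a + c) + (b + d)
  +-interchange = solve-∀ ℚ-ring
sumOn-+ (outside ∷ p) f g = sumOn-+ p (f ∘ suc) (g ∘ suc)

*-distribˡ-sumOn : ∀ {n} c (p : Subset n) f → c * sumOn p f ≡ sumOn p (λ v → c * f v)
*-distribˡ-sumOn c []            f = *-zeroʳ c
*-distribˡ-sumOn c (inside  ∷ p) f =
  trans (*-distribˡ-+ c (f zero) _) (cong (c * f zero +_) (*-distribˡ-sumOn c p (f ∘ suc)))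
*-distribˡ-sumOn c (outside ∷ p) f = *-distribˡ-sumOn c p (f ∘ suc)

sumOn-nonNeg : ∀ {n} (p : Subset n) {f} → (∀ v → 0ℚ ≤ f v) → 0ℚ ≤ sumOn p f
sumOn-nonNeg []            0≤f = ≤-refl
sumOn-nonNeg (inside  ∷ p) 0≤f = 0≤p+q (0≤f zero) (sumOn-nonNeg p (0≤f ∘ suc))
sumOn-nonNeg (outside ∷ p) 0≤f = sumOn-nonNeg p (0≤f ∘ suc)

sumOn-split : ∀ {n} (p q : Subset n) f → q ⊆ p → sumOn p f ≡ sumOn q f + sumOn (p ─ q) f
sumOn-split []            []            f q⊆p = refl
sumOn-split (inside  ∷ p) (inside  ∷ q) f q⊆p =
  trans (cong (f zero +_) (sumOn-split p q (f ∘ suc) (drop-∷-⊆ q⊆p))) (sym (+-assoc (f zero) _ _))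
sumOn-split (inside  ∷ p) (outside ∷ q) f q⊆p =
  trans (cong (f zero +_) (sumOn-split p q (f ∘ suc) (drop-∷-⊆ q⊆p)))
        (+-comm-middle (f zero) (sumOn q (f ∘ suc)) (sumOn (p ─ q) (f ∘ suc)))
  where
  +-comm-middle : ∀ a b c → a + (b + c) ≡ b + (a + c)
  +-comm-middle = solve-∀ ℚ-ring
sumOn-split (outside ∷ p) (inside  ∷ q) f q⊆p = contradiction (q⊆p here) λ ()
sumOn-split (outside ∷ p) (outside ∷ q) f q⊆p = sumOn-split p q (f ∘ suc) (drop-∷-⊆ q⊆p)

sumOn-⁅⁆ : ∀ {n} (v : Fin n) f → sumOn ⁅ v ⁆ f ≡ f v
sumOn-⁅⁆ zero    f = trans (cong (f zero +_) (sumOn-⊥ (f ∘ suc))) (+-identityʳ (f zero))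
sumOn-⁅⁆ (suc v) f = sumOn-⁅⁆ v (f ∘ suc)

sumOn-remove : ∀ {n} {p : Subset n} {v} f → v ∈ᵥ p → sumOn p f ≡ f v + sumOn (p ─ ⁅ v ⁆) f
sumOn-remove {p = p} {v} f v∈p =
  trans (sumOn-split p ⁅ v ⁆ f ⁅v⁆⊆p) (cong (_+ sumOn (p ─ ⁅ v ⁆) f) (sumOn-⁅⁆ v f))
  where
  ⁅v⁆⊆p : ⁅ v ⁆ ⊆ p
  ⁅v⁆⊆p w∈⁅v⁆ = subst (_∈ᵥ p) (sym (x∈⁅y⁆⇒x≡y _ w∈⁅v⁆)) v∈p

sumOn-const : ∀ {n} (p : Subset n) c → sumOn p (const c) ≡ ∣ p ∣ · c
sumOn-const []            c = refl
sumOn-const (inside  ∷ p) c = cong (c +_) (sumOn-const p c)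
sumOn-const (outside ∷ p) c = sumOn-const p c

sumOn-disjoint-≤ : ∀ {n} {A : Set} (x : Fin n → ℚ) (h : A → Subset n) {C} (L : List A) → (∀ v → 0ℚ ≤ x v) →
  AllPairs (λ a b → Empty (h a ∩ h b)) L → All (λ a → h a ⊆ C) L → ∑ₗ L (λ a → sumOn (h a) x) ≤ sumOn C x
sumOn-disjoint-≤ x h {C} []      0≤x []             []             = sumOn-nonNeg C 0≤x
sumOn-disjoint-≤ x h {C} (a ∷ L) 0≤x (disj ∷ pairs) (ha⊆C ∷ h⊆C) = begin
  sumOn (h a) x + ∑ₗ L (λ b → sumOn (h b) x)
    ≤⟨ +-monoʳ-≤ (sumOn (h a) x) (sumOn-disjoint-≤ x h L 0≤x pairs h⊆C-ha) ⟩
  sumOn (h a) x + sumOn (C ─ h a) x            ≡⟨ sumOn-split C (h a) x ha⊆C ⟨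
  sumOn C x                                    ∎
  where
  open ≤-Reasoning
  h⊆C-ha : All (λ b → h b ⊆ C ─ h a) L
  h⊆C-ha = All.zipWith (λ (ha∩hb≡∅ , hb⊆C) {w} w∈hb →
    x∈p∧x∉q⇒x∈p─q (hb⊆C w∈hb) (λ w∈ha → ha∩hb≡∅ (w , x∈p∩q⁺ (w∈ha , w∈hb)))) (disj , h⊆C)

prodOn-cong : ∀ {n} (p : Subset n) {x y} → (∀ {v} → v ∈ᵥ p → x v ≡ y v) → prodOn p x ≡ prodOn p y
prodOn-cong []            x≗y = refl
prodOn-cong (inside  ∷ p) x≗y = cong₂ _*_ (x≗y here) (prodOn-cong p (x≗y ∘ there))
prodOn-cong (outside ∷ p) x≗y = cong (1ℚ *_) (prodOn-cong p (x≗y ∘ there))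

prodOn-nonNeg : ∀ {n} (p : Subset n) {x} → (∀ v → 0ℚ ≤ x v) → 0ℚ ≤ prodOn p x
prodOn-nonNeg []            0≤x = nonNegative⁻¹ 1ℚ
prodOn-nonNeg (inside  ∷ p) 0≤x = 0≤p*q (0≤x zero) (prodOn-nonNeg p (0≤x ∘ suc))
prodOn-nonNeg (outside ∷ p) 0≤x = 0≤p*q (nonNegative⁻¹ 1ℚ) (prodOn-nonNeg p (0≤x ∘ suc))

prodOn-remove : ∀ {n} {p : Subset n} {v} x → v ∈ᵥ p → prodOn p x ≡ x v * prodOn (p ─ ⁅ v ⁆) x
prodOn-remove {p = inside ∷ p} x here =
  cong (x zero *_) (sym (trans (*-identityˡ _) (cong (λ q → prodOn q (x ∘ suc)) (p─⊥≡p p))))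
prodOn-remove {p = b ∷ p} {suc v} x (there v∈p) =
  trans (cong (B *_) (prodOn-remove (x ∘ suc) v∈p)) (swap B (x (suc v)) (prodOn (p ─ ⁅ v ⁆) (x ∘ suc)))
  where
  B : ℚ
  B = if b then x zero else 1ℚ
  swap : ∀ b a r → b * (a * r) ≡ a * (b * r)
  swap = solve-∀ ℚ-ring

prodOn-zero : ∀ {n} {p : Subset n} {v} x → v ∈ᵥ p → x v ≡ 0ℚ → prodOn p x ≡ 0ℚ
prodOn-zero {p = p} {v} x v∈p xv≡0 =
  trans (prodOn-remove x v∈p) (trans (cong (_* prodOn (p ─ ⁅ v ⁆) x) xv≡0) (*-zeroˡ (prodOn (p ─ ⁅ v ⁆) x)))

prodOn-const : ∀ {n} (p : Subset n) c → prodOn p (const c) ≡ c ^ ∣ p ∣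
prodOn-const []            c = refl
prodOn-const (inside  ∷ p) c = cong (c *_) (prodOn-const p c)
prodOn-const (outside ∷ p) c = trans (*-identityˡ _) (prodOn-const p c)

sumOn-x*prodOn-remove : ∀ {n} (p : Subset n) x →
  sumOn p (λ v → x v * prodOn (p ─ ⁅ v ⁆) x) ≡ ∣ p ∣ · prodOn p x
sumOn-x*prodOn-remove p x =
  trans (sumOn-cong p (λ v∈p → sym (prodOn-remove x v∈p))) (sumOn-const p (prodOn p x))

esym : ∀ {n} → ℕ → Subset n → (Fin n → ℚ) → ℚ
esym zero    p             x = 1ℚ
esym (suc k) []            x = 0ℚ
esym (suc k) (inside  ∷ p) x = x zero * esym k p (x ∘ suc) + esym (suc k) p (x ∘ suc)
esym (suc k) (outside ∷ p) x = esym (suc k) p (x ∘ suc)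

esym-outside : ∀ {n} k (p : Subset n) x → esym k (outside ∷ p) x ≡ esym k p (x ∘ suc)
esym-outside zero    p x = refl
esym-outside (suc k) p x = refl

esym-vanishes : ∀ {n} {k} (p : Subset n) x → ∣ p ∣ ℕ.< k → esym k p x ≡ 0ℚ
esym-vanishes {k = zero}  p             x ()
esym-vanishes {k = suc k} []            x _ = refl
esym-vanishes {k = suc k} (inside  ∷ p) x (ℕ.s≤s ∣p∣<k) = begin
  x zero * esym k p (x ∘ suc) + esym (suc k) p (x ∘ suc)
    ≡⟨ cong₂ (λ a b → x zero * a + b) (esym-vanishes p (x ∘ suc) ∣p∣<k)
                                        (esym-vanishes p (x ∘ suc) (ℕP.m<n⇒m<1+n ∣p∣<k)) ⟩
  x zero * 0ℚ + 0ℚ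
    ≡⟨ trans (+-identityʳ _) (*-zeroʳ (x zero)) ⟩
  0ℚ ∎
  where open ≡-Reasoning
esym-vanishes {k = suc k} (outside ∷ p) x ∣p∣<k = esym-vanishes p (x ∘ suc) ∣p∣<k

prodOn≡esym : ∀ {n} (p : Subset n) x → prodOn p x ≡ esym ∣ p ∣ p x
prodOn≡esym []            x = refl
prodOn≡esym (inside  ∷ p) x = trans (cong (x zero *_) (prodOn≡esym p (x ∘ suc)))
  (sym (trans (cong (x zero * esym ∣ p ∣ p (x ∘ suc) +_) (esym-vanishes p (x ∘ suc) (ℕP.n<1+n ∣ p ∣)))
              (+-identityʳ _)))
prodOn≡esym (outside ∷ p) x =
  trans (*-identityˡ _) (trans (prodOn≡esym p (x ∘ suc)) (sym (esym-outside ∣ p ∣ p x)))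

esym-1≡sumOn : ∀ {n} (p : Subset n) x → esym 1 p x ≡ sumOn p x
esym-1≡sumOn []            x = refl
esym-1≡sumOn (inside  ∷ p) x = cong₂ _+_ (*-identityʳ (x zero)) (esym-1≡sumOn p (x ∘ suc))
esym-1≡sumOn (outside ∷ p) x = esym-1≡sumOn p (x ∘ suc)

sumOn-prodOn-remove : ∀ {n} {k} (p : Subset n) x → ∣ p ∣ ≡ suc k →
  sumOn p (λ v → prodOn (p ─ ⁅ v ⁆) x) ≡ esym k p x
sumOn-prodOn-remove {k = k} (inside ∷ p) x ∣p∣≡k+1 = begin
  prodOn (outside ∷ (p ─ ⊥)) x + sumOn p (λ w → x zero * prodOn (p ─ ⁅ w ⁆) (x ∘ suc))
    ≡⟨ cong₂ _+_ (sym (trans (*-identityˡ _) (cong (λ q → prodOn q (x ∘ suc)) (p─⊥≡p p))))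
                 (*-distribˡ-sumOn (x zero) p g) ⟨
  prodOn p (x ∘ suc) + x zero * sumOn p g
    ≡⟨ step k (ℕP.suc-injective ∣p∣≡k+1) ⟩
  esym k (inside ∷ p) x ∎
  where
  open ≡-Reasoning
  g : Fin _ → ℚ
  g w = prodOn (p ─ ⁅ w ⁆) (x ∘ suc)
  step : ∀ k → ∣ p ∣ ≡ k →
    prodOn p (x ∘ suc) + x zero * sumOn p g ≡ esym k (inside ∷ p) x
  step zero ∣p∣≡0 = begin
    prodOn p (x ∘ suc) + x zero * sumOn p g
      ≡⟨ cong₂ (λ a b → a + x zero * b)
               (trans (prodOn≡esym p (x ∘ suc)) (cong (λ m → esym m p (x ∘ suc)) ∣p∣≡0))
               (trans (cong (λ q → sumOn q g) (∣p∣≡0⇒p≡⊥ {p = p} ∣p∣≡0)) (sumOn-⊥ g)) ⟩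
    1ℚ + x zero * 0ℚ
      ≡⟨ trans (cong (1ℚ +_) (*-zeroʳ (x zero))) (+-identityʳ 1ℚ) ⟩
    1ℚ ∎
  step (suc j) ∣p∣≡j+1 = begin
    prodOn p (x ∘ suc) + x zero * sumOn p g
      ≡⟨ cong₂ (λ a b → a + x zero * b)
               (trans (prodOn≡esym p (x ∘ suc)) (cong (λ m → esym m p (x ∘ suc)) ∣p∣≡j+1))
               (sumOn-prodOn-remove p (x ∘ suc) ∣p∣≡j+1) ⟩
    esym (suc j) p (x ∘ suc) + x zero * esym j p (x ∘ suc)
      ≡⟨ +-comm (esym (suc j) p (x ∘ suc)) (x zero * esym j p (x ∘ suc)) ⟩
    esym (suc j) (inside ∷ p) x ∎
sumOn-prodOn-remove {k = k} (outside ∷ p) x ∣p∣≡k+1 = begin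
  sumOn p (λ w → 1ℚ * prodOn (p ─ ⁅ w ⁆) (x ∘ suc)) ≡⟨ sumOn-cong p (λ _ → *-identityˡ _) ⟩
  sumOn p (λ w → prodOn (p ─ ⁅ w ⁆) (x ∘ suc))      ≡⟨ sumOn-prodOn-remove p (x ∘ suc) ∣p∣≡k+1 ⟩
  esym k p (x ∘ suc)                               ≡⟨ esym-outside k p x ⟨
  esym k (outside ∷ p) x                           ∎
  where open ≡-Reasoning

sumOn-x*sumOn-remove : ∀ {n} (p : Subset n) x → sumOn p (λ v → x v * sumOn (p ─ ⁅ v ⁆) x) ≡ 2 * esym 2 p x
sumOn-x*sumOn-remove []            x = sym (*-zeroʳ 2)
sumOn-x*sumOn-remove (inside  ∷ p) x = begin
  x zero * sumOn (p ─ ⊥) x′ + sumOn p (λ w → x′ w * (x zero + sumOn (p ─ ⁅ w ⁆) x′))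
    ≡⟨ cong₂ (λ q r → x zero * sumOn q x′ + r) (p─⊥≡p p)
             (sumOn-cong p (λ {w} _ → *-distribˡ-+ (x′ w) (x zero) (sumOn (p ─ ⁅ w ⁆) x′))) ⟩
  x zero * S + sumOn p (λ w → x′ w * x zero + x′ w * sumOn (p ─ ⁅ w ⁆) x′)
    ≡⟨ cong (x zero * S +_) (sumOn-+ p (λ w → x′ w * x zero) (λ w → x′ w * sumOn (p ─ ⁅ w ⁆) x′)) ⟩
  x zero * S + (sumOn p (λ w → x′ w * x zero) + sumOn p (λ w → x′ w * sumOn (p ─ ⁅ w ⁆) x′))
    ≡⟨ cong₂ (λ a b → x zero * S + (a + b))
             (trans (sumOn-cong p (λ {w} _ → *-comm (x′ w) (x zero))) (sym (*-distribˡ-sumOn (x zero) p x′)))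
             (sumOn-x*sumOn-remove p x′) ⟩
  x zero * S + (x zero * S + 2 * esym 2 p x′)
    ≡⟨ collect (x zero) S (esym 2 p x′) ⟩
  2 * (x zero * S + esym 2 p x′)
    ≡⟨ cong (λ s → 2 * (x zero * s + esym 2 p x′)) (esym-1≡sumOn p x′) ⟨
  2 * esym 2 (inside ∷ p) x ∎
  where
  open ≡-Reasoning
  x′ : Fin _ → ℚ
  x′ = x ∘ suc
  S : ℚ
  S = sumOn p x′
  collect : ∀ a s e → a * s + (a * s + 2 * e) ≡ 2 * (a * s + e)
  collect = solve-∀ ℚ-ring
sumOn-x*sumOn-remove (outside ∷ p) x = sumOn-x*sumOn-remove p (x ∘ suc)

pair-amgm : ∀ {n} (p : Subset n) x → ∣ p ∣ ≡ 2 → 4 * prodOn p x ≤ sumOn p x * sumOn p x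
pair-amgm (inside  ∷ p) x ∣p∣≡2 =
  ≤-by-gap ((x zero - S) * (x zero - S)) (0≤p*p (x zero - S))
    (trans (square (x zero) S) (cong (λ t → 4 * (x zero * t) + (x zero - S) * (x zero - S)) S≡P))
  where
  S : ℚ
  S = sumOn p (x ∘ suc)
  S≡P : S ≡ prodOn p (x ∘ suc)
  S≡P = sym (trans (prodOn≡esym p (x ∘ suc))
                   (trans (cong (λ m → esym m p (x ∘ suc)) (ℕP.suc-injective ∣p∣≡2))
                          (esym-1≡sumOn p (x ∘ suc))))
  square : ∀ a s → (a + s) * (a + s) ≡ 4 * (a * s) + (a - s) * (a - s)
  square = solve-∀ ℚ-ring
pair-amgm (outside ∷ p) x ∣p∣≡2 =
  subst (λ t → 4 * t ≤ sumOn p (x ∘ suc) * sumOn p (x ∘ suc)) (sym (*-identityˡ (prodOn p (x ∘ suc))))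
        (pair-amgm p (x ∘ suc) ∣p∣≡2)

-- Linear 3-graphs have Lagrangian at most 1/27

∑-∑ₗ-restrict : ∀ {n} (F : List (Subset n)) (g : Subset n → Fin n → ℚ) →
  ∑[ v < n ] ∑ₗ F (λ e → restrict e (g e) v) ≡ ∑ₗ F (λ e → sumOn e (g e))
∑-∑ₗ-restrict F g =
  trans (∑-∑ₗ-comm (λ v e → restrict e (g e) v) F) (∑ₗ-cong F (λ e → sym (sumOn≡∑restrict e (g e))))

∑-x*∑ₗ-restrict : ∀ {n} (F : List (Subset n)) (x : Fin n → ℚ) (g : Subset n → Fin n → ℚ) →
  ∑[ v < n ] (x v * ∑ₗ F (λ e → restrict e (g e) v)) ≡ ∑ₗ F (λ e → sumOn e (λ w → x w * g e w))
∑-x*∑ₗ-restrict F x g = trans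
  (sum-cong-≗ λ v → trans (*-distribˡ-∑ₗ (x v) (λ e → restrict e (g e) v) F)
                          (∑ₗ-cong F λ e → x*restrict e x (g e) v))
  (∑-∑ₗ-restrict F (λ e w → x w * g e w))

Linear : ∀ {n} → List (Subset n) → Set
Linear F = AllPairs (λ e f → ∣ e ∩ f ∣ ℕ.≤ 1) F

-- linkLagrangian F x v = ∂λ(F, x)/∂x_v is the Lagrangian of the link of v,
-- and linkWeight F x v is the total x-weight of the edges of that link.
linkLagrangian linkWeight : ∀ {n} → List (Subset n) → (Fin n → ℚ) → Fin n → ℚ
linkLagrangian F x v = ∑ₗ F (λ e → restrict e (λ w → prodOn (e ─ ⁅ w ⁆) x) v)
linkWeight     F x v = ∑ₗ F (λ e → restrict e (λ w → sumOn  (e ─ ⁅ w ⁆) x) v)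

∑-x*linkLagrangian : ∀ {n} (F : List (Subset n)) x → All (λ e → ∣ e ∣ ≡ 3) F →
  ∑[ v < n ] (x v * linkLagrangian F x v) ≡ 3 * lam F x
∑-x*linkLagrangian {n} F x sizes = begin
  ∑[ v < n ] (x v * linkLagrangian F x v)
    ≡⟨ ∑-x*∑ₗ-restrict F x (λ e w → prodOn (e ─ ⁅ w ⁆) x) ⟩
  ∑ₗ F (λ e → sumOn e (λ w → x w * prodOn (e ─ ⁅ w ⁆) x))
    ≡⟨ ∑ₗ-congᴬ F (All.map (λ {e} → euler {e}) sizes) ⟩
  ∑ₗ F (λ e → 3 * prodOn e x)
    ≡⟨ *-distribˡ-∑ₗ 3 (λ e → prodOn e x) F ⟨
  3 * ∑ₗ F (λ e → prodOn e x)
    ≡⟨ cong (3 *_) (lam≡∑ₗ F x) ⟨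
  3 * lam F x ∎
  where
  open ≡-Reasoning
  three-times : ∀ c → c + (c + (c + 0ℚ)) ≡ 3 * c
  three-times = solve-∀ ℚ-ring
  euler : ∀ {e} → ∣ e ∣ ≡ 3 → sumOn e (λ w → x w * prodOn (e ─ ⁅ w ⁆) x) ≡ 3 * prodOn e x
  euler {e} ∣e∣≡3 =
    trans (sumOn-x*prodOn-remove e x) (trans (cong (_· prodOn e x) ∣e∣≡3) (three-times (prodOn e x)))

∑-x*linkWeight : ∀ {n} (F : List (Subset n)) x → All (λ e → ∣ e ∣ ≡ 3) F →
  ∑[ v < n ] (x v * linkWeight F x v) ≡ 2 * ∑[ v < n ] linkLagrangian F x v
∑-x*linkWeight {n} F x sizes = begin
  ∑[ v < n ] (x v * linkWeight F x v)
    ≡⟨ ∑-x*∑ₗ-restrict F x (λ e w → sumOn (e ─ ⁅ w ⁆) x) ⟩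
  ∑ₗ F (λ e → sumOn e (λ w → x w * sumOn (e ─ ⁅ w ⁆) x))
    ≡⟨ ∑ₗ-cong F (λ e → sumOn-x*sumOn-remove e x) ⟩
  ∑ₗ F (λ e → 2 * esym 2 e x)
    ≡⟨ *-distribˡ-∑ₗ 2 (λ e → esym 2 e x) F ⟨
  2 * ∑ₗ F (λ e → esym 2 e x)
    ≡⟨ cong (2 *_) (∑ₗ-congᴬ F (All.map (λ {e} ∣e∣≡3 → sumOn-prodOn-remove e x ∣e∣≡3) sizes)) ⟨
  2 * ∑ₗ F (λ e → sumOn e (λ w → prodOn (e ─ ⁅ w ⁆) x))
    ≡⟨ cong (2 *_) (∑-∑ₗ-restrict F (λ e w → prodOn (e ─ ⁅ w ⁆) x)) ⟨
  2 * ∑[ v < n ] linkLagrangian F x v ∎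
  where open ≡-Reasoning

link : ∀ {n} → Subset n → Fin n → Subset n
link e v = if lookup e v then e ─ ⁅ v ⁆ else ⊥

link-∈ : ∀ {n} {e : Subset n} {v} → v ∈ᵥ e → link e v ≡ e ─ ⁅ v ⁆
link-∈ {e = e} {v} v∈e = cong (λ b → if b then e ─ ⁅ v ⁆ else ⊥) ([]=⇒lookup v∈e)

link-∉ : ∀ {n} {e : Subset n} {v} → v ∉ᵥ e → link e v ≡ ⊥
link-∉ {e = e} {v} v∉e = cong (λ b → if b then e ─ ⁅ v ⁆ else ⊥) (∉⇒lookup≡outside v∉e)

restrict≡sumOn-link : ∀ {n} (e : Subset n) x v → restrict e (λ w → sumOn (e ─ ⁅ w ⁆) x) v ≡ sumOn (link e v) x
restrict≡sumOn-link e x v with v ∈? e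
... | yes v∈e = trans (restrict-∈ {p = e} (λ w → sumOn (e ─ ⁅ w ⁆) x) v∈e)
                      (cong (λ q → sumOn q x) (sym (link-∈ v∈e)))
... | no  v∉e = trans (restrict-∉ {p = e} (λ w → sumOn (e ─ ⁅ w ⁆) x) v∉e)
                      (trans (sym (sumOn-⊥ x)) (cong (λ q → sumOn q x) (sym (link-∉ v∉e))))

∈-link : ∀ {n} {e : Subset n} {v w} → w ∈ᵥ link e v → v ∈ᵥ e × w ∈ᵥ e × w ≢ v
∈-link {e = e} {v} {w} w∈link with v ∈? e
... | yes v∈e = v∈e , x∈p-y⇒x∈p×x≢y (subst (w ∈ᵥ_) (link-∈ v∈e) w∈link)
... | no  v∉e = contradiction (subst (w ∈ᵥ_) (link-∉ v∉e) w∈link) ∉⊥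

links-disjoint : ∀ {n} {e f : Subset n} v → ∣ e ∩ f ∣ ℕ.≤ 1 → Empty (link e v ∩ link f v)
links-disjoint {e = e} {f} v ∣e∩f∣≤1 (w , w∈∩) = ℕP.<⇒≱ 2≤∣e∩f∣ ∣e∩f∣≤1
  where
  2≤∣e∩f∣ : 2 ℕ.≤ ∣ e ∩ f ∣
  2≤∣e∩f∣ with x∈p∩q⁻ (link e v) (link f v) w∈∩
  ... | w∈link-e , w∈link-f with ∈-link {e = e} w∈link-e | ∈-link {e = f} w∈link-f
  ... | v∈e , w∈e , w≢v | v∈f , w∈f , _ = x,y∈p⇒2≤∣p∣ (x∈p∩q⁺ (w∈e , w∈f)) (x∈p∩q⁺ (v∈e , v∈f)) w≢v

linkWeight+x≤∑x : ∀ {n} (F : List (Subset n)) x → Linear F → (∀ v → 0ℚ ≤ x v) →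
  ∀ v → linkWeight F x v + x v ≤ sum x
linkWeight+x≤∑x F x linear 0≤x v = begin
  linkWeight F x v + x v                 ≡⟨ cong (_+ x v) (∑ₗ-cong F (λ e → restrict≡sumOn-link e x v)) ⟩
  ∑ₗ F (λ e → sumOn (link e v) x) + x v  ≤⟨ +-monoˡ-≤ (x v) (sumOn-disjoint-≤ x (λ e → link e v) F 0≤x
                                                        links-disjoint′ (All.universal link⊆ F)) ⟩
  sumOn (⊤ ─ ⁅ v ⁆) x + x v             ≡⟨ +-comm (sumOn (⊤ ─ ⁅ v ⁆) x) (x v) ⟩
  x v + sumOn (⊤ ─ ⁅ v ⁆) x             ≡⟨ sumOn-remove x ∈⊤ ⟨
  sumOn ⊤ x                              ≡⟨ sumOn-⊤ x ⟩
  sum x                                  ∎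
  where
  open ≤-Reasoning
  links-disjoint′ : AllPairs (λ e f → Empty (link e v ∩ link f v)) F
  links-disjoint′ = AllPairs.map (λ {e} {f} → links-disjoint {e = e} {f} v) linear
  link⊆ : ∀ e → link e v ⊆ ⊤ ─ ⁅ v ⁆
  link⊆ e w∈link = x∈p∧x≢y⇒x∈p-y ∈⊤ (proj₂ (proj₂ (∈-link {e = e} w∈link)))

4*linkLagrangian≤linkWeight² : ∀ {n} (F : List (Subset n)) x → All (λ e → ∣ e ∣ ≡ 3) F → (∀ v → 0ℚ ≤ x v) →
  ∀ v → 4 * linkLagrangian F x v ≤ linkWeight F x v * linkWeight F x v
4*linkLagrangian≤linkWeight² F x sizes 0≤x v =
  ∑ₗ-square-bound F (All.map (λ {e} → edge-bound e) sizes)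
  where
  edge-bound : ∀ e → ∣ e ∣ ≡ 3 →
    4 * restrict e (λ w → prodOn (e ─ ⁅ w ⁆) x) v
      ≤ restrict e (λ w → sumOn (e ─ ⁅ w ⁆) x) v * restrict e (λ w → sumOn (e ─ ⁅ w ⁆) x) v
    × 0ℚ ≤ restrict e (λ w → sumOn (e ─ ⁅ w ⁆) x) v
  edge-bound e ∣e∣≡3 with v ∈? e
  ... | yes v∈e rewrite restrict-∈ {p = e} (λ w → prodOn (e ─ ⁅ w ⁆) x) v∈e
                      | restrict-∈ {p = e} (λ w → sumOn (e ─ ⁅ w ⁆) x) v∈e =
    pair-amgm (e ─ ⁅ v ⁆) x (ℕP.suc-injective (trans (x∈p⇒suc∣p-x∣≡∣p∣ v∈e) ∣e∣≡3)) ,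
    sumOn-nonNeg (e ─ ⁅ v ⁆) 0≤x
  ... | no  v∉e rewrite restrict-∉ {p = e} (λ w → prodOn (e ─ ⁅ w ⁆) x) v∉e
                      | restrict-∉ {p = e} (λ w → sumOn (e ─ ⁅ w ⁆) x) v∉e = ≤-refl , ≤-refl

-- Used at each vertex v with a = x_v, m = linkLagrangian F x v and t = linkWeight F x v.
vertex-bound : ∀ {a m t} → 0ℚ ≤ a → 0ℚ ≤ m → 0ℚ ≤ t → t + a ≤ 1ℚ → 4 * m ≤ t * t →
  9 * (a * m) ≤ 2 * m + a * a
vertex-bound {a} {m} {t} 0≤a 0≤m 0≤t t+a≤1 4m≤t² with 9 * a ≤? 2
... | yes 9a≤2 = ≤-by-gap ((2 - 9 * a) * m + a * a) (0≤p+q (0≤p*q (0≤q-p 9a≤2) 0≤m) (0≤p*p a)) (small-gap a m)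
  where
  small-gap : ∀ a m → 2 * m + a * a ≡ 9 * (a * m) + ((2 - 9 * a) * m + a * a)
  small-gap = solve-∀ ℚ-ring
... | no  9a≰2 = *-cancelˡ-≤-pos 4 (≤-by-gap gap 0≤gap (large-gap a m))
  where
  gap : ℚ
  gap = (9 * a - 2) * ((1ℚ - a) * (1ℚ - a) - 4 * m) + (3 * a - 1ℚ) * (3 * a - 1ℚ) * (2 - a)
  large-gap : ∀ a m → 4 * (2 * m + a * a) ≡
    4 * (9 * (a * m)) + ((9 * a - 2) * ((1ℚ - a) * (1ℚ - a) - 4 * m) + (3 * a - 1ℚ) * (3 * a - 1ℚ) * (2 - a))
  large-gap = solve-∀ ℚ-ring
  t≤1-a : t ≤ 1ℚ - a
  t≤1-a = subst₂ _≤_ (+-cancel a t) refl (+-monoˡ-≤ (- a) t+a≤1)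
    where
    +-cancel : ∀ a t → (t + a) - a ≡ t
    +-cancel = solve-∀ ℚ-ring
  4m≤[1-a]² : 4 * m ≤ (1ℚ - a) * (1ℚ - a)
  4m≤[1-a]² = ≤-trans 4m≤t² (≤-trans (*-monoˡ-≤-0≤ 0≤t t≤1-a)
    (subst₂ _≤_ (*-comm (1ℚ - a) t) refl (*-monoˡ-≤-0≤ (≤-trans 0≤t t≤1-a) t≤1-a)))
  a≤2 : a ≤ 2
  a≤2 = ≤-trans (≤-trans (subst (_≤ t + a) (+-identityˡ a) (+-monoˡ-≤ a 0≤t)) t+a≤1) (≤ᵇ⇒≤ tt)
  0≤gap : 0ℚ ≤ gap
  0≤gap = 0≤p+q (0≤p*q (0≤q-p (<⇒≤ (≰⇒> 9a≰2))) (0≤q-p 4m≤[1-a]²))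
                (0≤p*q (0≤p*p (3 * a - 1ℚ)) (0≤q-p a≤2))

linear-lagrangian≤1/27 : ∀ {n} (F : List (Subset n)) x → All (λ e → ∣ e ∣ ≡ 3) F → Linear F →
  InSimplex ⊤ x → 27 * lam F x ≤ 1ℚ
linear-lagrangian≤1/27 {n} F x sizes linear (0≤x , _ , ∑x≡1) = begin
  27 * lam F x
    ≡⟨ trans (cong (9 *_) (∑-x*linkLagrangian F x sizes)) (sym (*-assoc 9 3 (lam F x))) ⟨
  9 * ∑[ v < n ] (x v * M v)
    ≡⟨ *-distribˡ-sum 9 (λ v → x v * M v) ⟩
  ∑[ v < n ] (9 * (x v * M v))
    ≤⟨ ∑-mono-≤ vertex-bound′ ⟩
  ∑[ v < n ] (2 * M v + x v * x v)
    ≡⟨ ∑-distrib-+ (λ v → 2 * M v) (λ v → x v * x v) ⟩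
  ∑[ v < n ] (2 * M v) + ∑[ v < n ] (x v * x v)
    ≡⟨ cong (_+ ∑[ v < n ] (x v * x v)) (trans (∑-x*linkWeight F x sizes) (*-distribˡ-sum 2 M)) ⟨
  ∑[ v < n ] (x v * T v) + ∑[ v < n ] (x v * x v)
    ≡⟨ ∑-distrib-+ (λ v → x v * T v) (λ v → x v * x v) ⟨
  ∑[ v < n ] (x v * T v + x v * x v)
    ≤⟨ ∑-mono-≤ weight-bound ⟩
  ∑[ v < n ] x v
    ≡⟨ trans (sym (sumF≡sum x)) ∑x≡1 ⟩
  1ℚ ∎
  where
  open ≤-Reasoning
  M T : Fin n → ℚ
  M = linkLagrangian F x
  T = linkWeight F x
  T+x≤1 : ∀ v → T v + x v ≤ 1ℚ
  T+x≤1 v = subst (T v + x v ≤_) (trans (sym (sumF≡sum x)) ∑x≡1) (linkWeight+x≤∑x F x linear 0≤x v)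
  vertex-bound′ : ∀ v → 9 * (x v * M v) ≤ 2 * M v + x v * x v
  vertex-bound′ v = vertex-bound (0≤x v)
    (∑ₗ-nonNeg F (All.universal (λ e → restrict-nonNeg e (λ w → prodOn-nonNeg (e ─ ⁅ w ⁆) 0≤x) v) F))
    (∑ₗ-nonNeg F (All.universal (λ e → restrict-nonNeg e (λ w → sumOn-nonNeg (e ─ ⁅ w ⁆) 0≤x) v) F))
    (T+x≤1 v) (4*linkLagrangian≤linkWeight² F x sizes 0≤x v)
  weight-bound : ∀ v → x v * T v + x v * x v ≤ x v
  weight-bound v =
    subst₂ _≤_ (*-distribˡ-+ (x v) (T v) (x v)) (*-identityʳ (x v)) (*-monoˡ-≤-0≤ (0≤x v) (T+x≤1 v))

-- Dense 3-graphs cover all pairs of vertices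

edgesAvoiding : ∀ {n} → Fin n → List (Subset n) → List (Subset n)
edgesAvoiding v = filter (λ e → ¬? (v ∈? e))

edgesAvoiding-subgraph : ∀ {n} (v : Fin n) (F : List (Subset n)) → Unique F →
  IsSubgraphOn (edgesAvoiding v F) (⊤ ─ ⁅ v ⁆) F
edgesAvoiding-subgraph v F unique = Unique.filter⁺ (λ e → ¬? (v ∈? e)) unique , All.tabulate edge-property
  where
  edge-property : ∀ {e} → e ∈ edgesAvoiding v F → e ∈ F × e ⊆ ⊤ ─ ⁅ v ⁆
  edge-property {e} e∈ with ∈-filter⁻ (λ e → ¬? (v ∈? e)) e∈
  ... | e∈F , v∉e = e∈F , λ w∈e → x∈p∧x≢y⇒x∈p-y ∈⊤ (λ w≡v → v∉e (subst (_∈ᵥ e) w≡v w∈e))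

lam-edgesAvoiding : ∀ {n} (v : Fin n) (F : List (Subset n)) y → y v ≡ 0ℚ → lam (edgesAvoiding v F) y ≡ lam F y
lam-edgesAvoiding v []      y yv≡0 = refl
lam-edgesAvoiding v (e ∷ F) y yv≡0 with v ∈? e
... | yes v∈e = trans (lam-edgesAvoiding v F y yv≡0)
                      (sym (trans (cong (_+ lam F y) (prodOn-zero y v∈e yv≡0)) (+-identityˡ (lam F y))))
... | no  v∉e = cong (prodOn e y +_) (lam-edgesAvoiding v F y yv≡0)

x∉⊤-x : ∀ {n} (v : Fin n) → v ∉ᵥ ⊤ ─ ⁅ v ⁆
x∉⊤-x v v∈ = proj₂ (x∈p-y⇒x∈p×x≢y v∈) refl

∣⊤-x∣<n : ∀ {n} (v : Fin n) → ∣ ⊤ ─ ⁅ v ⁆ ∣ ℕ.< n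
∣⊤-x∣<n {n} v = subst (∣ ⊤ ─ ⁅ v ⁆ ∣ ℕ.<_) (∣⊤∣≡n n) (x∈p⇒∣p-x∣<∣p∣ (∈⊤ {x = v}))

∉⊤-x⇒≡ : ∀ {n} {v w : Fin n} → w ∉ᵥ ⊤ ─ ⁅ v ⁆ → w ≡ v
∉⊤-x⇒≡ {v = v} {w} w∉ with w ≟ᶠ v
... | yes w≡v = w≡v
... | no  w≢v = contradiction (x∈p∧x≢y⇒x∈p-y ∈⊤ w≢v) w∉

dense⇒vertex-deletion : ∀ {n} {F : List (Subset n)} → Unique F → Dense F → (v : Fin n) →
  ∃ λ x → InSimplex ⊤ x × (∀ y → InSimplex (⊤ ─ ⁅ v ⁆) y → lam F y < lam F x)
dense⇒vertex-deletion {n} {F} unique dense v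
  with dense (⊤ ─ ⁅ v ⁆) (edgesAvoiding v F) (∣⊤-x∣<n v) (edgesAvoiding-subgraph v F unique)
... | x , x∈Δ , ε , 0<ε , gap = x , x∈Δ , λ y y∈Δ → begin-strict
  lam F y                        ≡⟨ lam-edgesAvoiding v F y (proj₁ (proj₂ y∈Δ) v (x∉⊤-x v)) ⟨
  lam (edgesAvoiding v F) y      <⟨ p<p+q 0<ε ⟩
  lam (edgesAvoiding v F) y + ε  ≤⟨ gap y y∈Δ ⟩
  lam F x                        ∎
  where open ≤-Reasoning

moveWeight : ∀ {n} → (Fin n → ℚ) → Fin n → Fin n → Fin n → ℚ
moveWeight x v u = updateAt (updateAt x u (_+ x v)) v (const 0ℚ)

moveWeight-source : ∀ {n} (x : Fin n → ℚ) v u → moveWeight x v u v ≡ 0ℚ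
moveWeight-source x v u = updateAt-updates v (updateAt x u (_+ x v))

moveWeight-target : ∀ {n} (x : Fin n → ℚ) {v u} → u ≢ v → moveWeight x v u u ≡ x u + x v
moveWeight-target x {v} {u} u≢v =
  trans (updateAt-minimal u v (updateAt x u (_+ x v)) u≢v) (updateAt-updates u x)

moveWeight-other : ∀ {n} (x : Fin n → ℚ) {v u w} → w ≢ u → w ≢ v → moveWeight x v u w ≡ x w
moveWeight-other x {v} {u} {w} w≢u w≢v =
  trans (updateAt-minimal w v (updateAt x u (_+ x v)) w≢v) (updateAt-minimal w u x w≢u)

moveWeight-idle : ∀ {n} (x : Fin n → ℚ) v u → x v ≡ 0ℚ → ∀ w → moveWeight x v u w ≡ x w
moveWeight-idle x v u xv≡0 w with w ≟ᶠ v | w ≟ᶠ u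
... | yes refl | _        = trans (moveWeight-source x w u) (sym xv≡0)
... | no  w≢v  | yes refl = trans (moveWeight-target x w≢v) (trans (cong (x w +_) xv≡0) (+-identityʳ (x w)))
... | no  w≢v  | no  w≢u  = moveWeight-other x w≢u w≢v

∑-moveWeight : ∀ {n} (x : Fin n → ℚ) {v u} → u ≢ v → sum (moveWeight x v u) ≡ sum x
∑-moveWeight x {v} {u} u≢v = +-cancelʳ (x v) _ _ (+-cancelʳ (x u) _ _ (begin
  (sum (moveWeight x v u) + x v) + x u  ≡⟨ cong (λ t → (sum (moveWeight x v u) + t) + x u) x′v≡xv ⟨
  (sum (moveWeight x v u) + x′ v) + x u ≡⟨ cong (_+ x u) (∑-updateAt x′ v (const 0ℚ)) ⟩
  (sum x′ + 0ℚ) + x u                   ≡⟨ cong (_+ x u) (+-identityʳ (sum x′)) ⟩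
  sum x′ + x u                          ≡⟨ ∑-updateAt x u (_+ x v) ⟩
  sum x + (x u + x v)                   ≡⟨ shuffle (sum x) (x u) (x v) ⟩
  (sum x + x v) + x u                   ∎))
  where
  open ≡-Reasoning
  x′ : Fin _ → ℚ
  x′ = updateAt x u (_+ x v)
  x′v≡xv : x′ v ≡ x v
  x′v≡xv = updateAt-minimal v u x (u≢v ∘ sym)
  shuffle : ∀ s a b → s + (a + b) ≡ (s + b) + a
  shuffle = solve-∀ ℚ-ring

moveWeight-∈Δ : ∀ {n} {x : Fin n → ℚ} {v u} → InSimplex ⊤ x → u ≢ v → InSimplex (⊤ ─ ⁅ v ⁆) (moveWeight x v u)
moveWeight-∈Δ {x = x} {v} {u} (0≤x , _ , ∑x≡1) u≢v = 0≤y , zero-off-support , ∑y≡1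
  where
  0≤y : ∀ w → 0ℚ ≤ moveWeight x v u w
  0≤y w with w ≟ᶠ v | w ≟ᶠ u
  ... | yes refl | _        = subst (0ℚ ≤_) (sym (moveWeight-source x w u)) ≤-refl
  ... | no  w≢v  | yes refl = subst (0ℚ ≤_) (sym (moveWeight-target x w≢v)) (0≤p+q (0≤x w) (0≤x v))
  ... | no  w≢v  | no  w≢u  = subst (0ℚ ≤_) (sym (moveWeight-other x w≢u w≢v)) (0≤x w)
  zero-off-support : ∀ w → w ∉ᵥ ⊤ ─ ⁅ v ⁆ → moveWeight x v u w ≡ 0ℚ
  zero-off-support w w∉ = subst (λ w → moveWeight x v u w ≡ 0ℚ) (sym (∉⊤-x⇒≡ w∉)) (moveWeight-source x v u)
  ∑y≡1 : sumF (moveWeight x v u) ≡ 1ℚ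
  ∑y≡1 = trans (sumF≡sum (moveWeight x v u)) (trans (∑-moveWeight x u≢v) (trans (sym (sumF≡sum x)) ∑x≡1))

prodOn-moveWeight-target : ∀ {n} (x : Fin n → ℚ) {e v u} → u ∈ᵥ e → v ∉ᵥ e → u ≢ v →
  prodOn e (moveWeight x v u) ≡ (x u + x v) * prodOn (e ─ ⁅ u ⁆) x
prodOn-moveWeight-target x {e} {v} {u} u∈e v∉e u≢v =
  trans (prodOn-remove (moveWeight x v u) u∈e)
        (cong₂ _*_ (moveWeight-target x u≢v) (prodOn-cong (e ─ ⁅ u ⁆) agree))
  where
  agree : ∀ {w} → w ∈ᵥ e ─ ⁅ u ⁆ → moveWeight x v u w ≡ x w
  agree {w} w∈e-u with x∈p-y⇒x∈p×x≢y w∈e-u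
  ... | w∈e , w≢u = moveWeight-other x w≢u (λ w≡v → v∉e (subst (_∈ᵥ e) w≡v w∈e))

prodOn-moveWeight-away : ∀ {n} (x : Fin n → ℚ) {e v u} → u ∉ᵥ e → v ∉ᵥ e →
  prodOn e (moveWeight x v u) ≡ prodOn e x
prodOn-moveWeight-away x {e} u∉e v∉e = prodOn-cong e λ w∈e →
  moveWeight-other x (λ w≡u → u∉e (subst (_∈ᵥ e) w≡u w∈e)) (λ w≡v → v∉e (subst (_∈ᵥ e) w≡v w∈e))

moveWeight-split-one : ∀ {n} (x : Fin n → ℚ) {e u v} → u ∈ᵥ e → v ∉ᵥ e → u ≢ v →
  (x u + x v) * prodOn e x ≡ x u * prodOn e (moveWeight x v u) + x v * prodOn e (moveWeight x u v)
moveWeight-split-one x {e} {u} {v} u∈e v∉e u≢v = begin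
  (x u + x v) * prodOn e x
    ≡⟨ cong ((x u + x v) *_) (prodOn-remove x u∈e) ⟩
  (x u + x v) * (x u * R)
    ≡⟨ rearrange (x u) (x v) R ⟩
  x u * ((x u + x v) * R) + x v * 0ℚ
    ≡⟨ cong₂ (λ a b → x u * a + x v * b) (prodOn-moveWeight-target x u∈e v∉e u≢v)
                                         (prodOn-zero (moveWeight x u v) u∈e (moveWeight-source x u v)) ⟨
  x u * prodOn e (moveWeight x v u) + x v * prodOn e (moveWeight x u v) ∎
  where
  open ≡-Reasoning
  R : ℚ
  R = prodOn (e ─ ⁅ u ⁆) x
  rearrange : ∀ a b r → (a + b) * (a * r) ≡ a * ((a + b) * r) + b * 0ℚ
  rearrange = solve-∀ ℚ-ring

moveWeight-split : ∀ {n} (x : Fin n → ℚ) {u v} e → u ≢ v → ¬ (u ∈ᵥ e × v ∈ᵥ e) →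
  (x u + x v) * prodOn e x ≡ x u * prodOn e (moveWeight x v u) + x v * prodOn e (moveWeight x u v)
moveWeight-split x {u} {v} e u≢v ¬both with u ∈? e | v ∈? e
... | yes u∈e | yes v∈e = contradiction (u∈e , v∈e) ¬both
... | yes u∈e | no  v∉e = moveWeight-split-one x u∈e v∉e u≢v
... | no  u∉e | yes v∈e = begin
  (x u + x v) * prodOn e x ≡⟨ cong (_* prodOn e x) (+-comm (x u) (x v)) ⟩
  (x v + x u) * prodOn e x ≡⟨ moveWeight-split-one x v∈e u∉e (u≢v ∘ sym) ⟩
  x v * prodOn e (moveWeight x u v) + x u * prodOn e (moveWeight x v u)
    ≡⟨ +-comm (x v * prodOn e (moveWeight x u v)) (x u * prodOn e (moveWeight x v u)) ⟩
  x u * prodOn e (moveWeight x v u) + x v * prodOn e (moveWeight x u v) ∎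
  where open ≡-Reasoning
... | no  u∉e | no  v∉e = begin
  (x u + x v) * prodOn e x                                    ≡⟨ *-distribʳ-+ (prodOn e x) (x u) (x v) ⟩
  x u * prodOn e x + x v * prodOn e x                         ≡⟨ cong₂ (λ a b → x u * a + x v * b)
                                                                   (prodOn-moveWeight-away x u∉e v∉e)
                                                                   (prodOn-moveWeight-away x v∉e u∉e) ⟨
  x u * prodOn e (moveWeight x v u) + x v * prodOn e (moveWeight x u v) ∎
  where open ≡-Reasoning

lam-moveWeight-split : ∀ {n} (x : Fin n → ℚ) {u v} (F : List (Subset n)) → u ≢ v →
  All (λ e → ¬ (u ∈ᵥ e × v ∈ᵥ e)) F →
  (x u + x v) * lam F x ≡ x u * lam F (moveWeight x v u) + x v * lam F (moveWeight x u v)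
lam-moveWeight-split x {u} {v} []      u≢v []             = zeros (x u + x v) (x u) (x v)
  where
  zeros : ∀ s a b → s * 0ℚ ≡ a * 0ℚ + b * 0ℚ
  zeros = solve-∀ ℚ-ring
lam-moveWeight-split x {u} {v} (e ∷ F) u≢v (¬both ∷ ¬boths) = begin
  (x u + x v) * (prodOn e x + lam F x)
    ≡⟨ *-distribˡ-+ (x u + x v) (prodOn e x) (lam F x) ⟩
  (x u + x v) * prodOn e x + (x u + x v) * lam F x
    ≡⟨ cong₂ _+_ (moveWeight-split x e u≢v ¬both) (lam-moveWeight-split x F u≢v ¬boths) ⟩
  (x u * prodOn e yᵤ + x v * prodOn e yᵥ) + (x u * lam F yᵤ + x v * lam F yᵥ)
    ≡⟨ collect (x u) (x v) (prodOn e yᵤ) (prodOn e yᵥ) (lam F yᵤ) (lam F yᵥ) ⟩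
  x u * (prodOn e yᵤ + lam F yᵤ) + x v * (prodOn e yᵥ + lam F yᵥ) ∎
  where
  open ≡-Reasoning
  yᵤ yᵥ : Fin _ → ℚ
  yᵤ = moveWeight x v u
  yᵥ = moveWeight x u v
  collect : ∀ a b p q r s → (a * p + b * q) + (a * r + b * s) ≡ a * (p + r) + b * (q + s)
  collect = solve-∀ ℚ-ring

lam-cong : ∀ {n} (F : List (Subset n)) {x y} → (∀ w → x w ≡ y w) → lam F x ≡ lam F y
lam-cong []      x≗y = refl
lam-cong (e ∷ F) x≗y = cong₂ _+_ (prodOn-cong e (λ {w} _ → x≗y w)) (lam-cong F x≗y)

lam-moveWeight : ∀ {n} {x : Fin n → ℚ} {u v} (F : List (Subset n)) → (∀ w → 0ℚ ≤ x w) → u ≢ v →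
  All (λ e → ¬ (u ∈ᵥ e × v ∈ᵥ e)) F → lam F x ≤ lam F (moveWeight x v u) ⊎ lam F x ≤ lam F (moveWeight x u v)
lam-moveWeight {x = x} {u} {v} F 0≤x u≢v ¬boths with 0ℚ <? x u + x v
... | yes 0<xu+xv = ≤-weighted-average (0≤x u) (0≤x v) 0<xu+xv (lam-moveWeight-split x F u≢v ¬boths)
... | no  0≮xu+xv = inj₁ (≤-reflexive (lam-cong F (λ w → sym (moveWeight-idle x v u xv≡0 w))))
  where
  xv≡0 : x v ≡ 0ℚ
  xv≡0 = ≤-antisym (≤-trans (subst (_≤ x u + x v) (+-identityˡ (x v)) (+-monoˡ-≤ (x v) (0≤x u))) (≮⇒≥ 0≮xu+xv))
                   (0≤x v)

CoversPairs : ∀ {n} → List (Subset n) → Set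
CoversPairs {n} F = ∀ {u v : Fin n} → u ≢ v → Any (λ e → u ∈ᵥ e × v ∈ᵥ e) F

-- If no edge contained u and v, the better of the points witnessing that deleting v,
-- resp. u, lowers the Lagrangian could be merged onto u or onto v without lowering it.
dense⇒covers-pairs : ∀ {n} {F : List (Subset n)} → Unique F → Dense F → CoversPairs F
dense⇒covers-pairs {F = F} unique dense {u} {v} u≢v =
  decidable-stable (any? (λ e → u ∈? e ×-dec v ∈? e) F) (λ uncovered → refute (¬Any⇒All¬ F uncovered))
  where
  refute : ¬ All (λ e → ¬ (u ∈ᵥ e × v ∈ᵥ e)) F
  refute ¬boths with dense⇒vertex-deletion unique dense v | dense⇒vertex-deletion unique dense u
  ... | x₁ , x₁∈Δ , drop-v | x₂ , x₂∈Δ , drop-u =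
    [ (λ x₁≤x₂ → no-point-above-both x₂ x₂∈Δ x₁≤x₂ ≤-refl)
    , (λ x₂≤x₁ → no-point-above-both x₁ x₁∈Δ ≤-refl x₂≤x₁) ]′ (≤-total (lam F x₁) (lam F x₂))
    where
    no-point-above-both : ∀ x → InSimplex ⊤ x → lam F x₁ ≤ lam F x → ¬ (lam F x₂ ≤ lam F x)
    no-point-above-both x x∈Δ x₁≤x x₂≤x with lam-moveWeight F (proj₁ x∈Δ) u≢v ¬boths
    ... | inj₁ x≤yᵤ = <-irrefl refl (<-≤-trans (drop-v _ (moveWeight-∈Δ x∈Δ u≢v)) (≤-trans x₁≤x x≤yᵤ))
    ... | inj₂ x≤yᵥ = <-irrefl refl (<-≤-trans (drop-u _ (moveWeight-∈Δ x∈Δ (u≢v ∘ sym))) (≤-trans x₂≤x x≤yᵥ))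

-- Two edges meeting in one, resp. two, vertices

EdgesMeetingIn : ∀ {n} → ℕ → List (Subset n) → Set
EdgesMeetingIn {n} k F = Σ (Subset n) λ e₁ → Σ (Subset n) λ e₂ → (e₁ ∈ F) × (e₂ ∈ F) × (∣ e₁ ∩ e₂ ∣ ≡ k)

edges-meeting-in? : ∀ {n} k (F : List (Subset n)) → Dec (EdgesMeetingIn k F)
edges-meeting-in? k F = map′ from to (any? (λ e₁ → any? (λ e₂ → ∣ e₁ ∩ e₂ ∣ ℕ.≟ k) F) F)
  where
  from : Any (λ e₁ → Any (λ e₂ → ∣ e₁ ∩ e₂ ∣ ≡ k) F) F → EdgesMeetingIn k F
  from meeting with find meeting
  ... | e₁ , e₁∈F , meeting′ with find meeting′
  ... | e₂ , e₂∈F , ∣e₁∩e₂∣≡k = e₁ , e₂ , e₁∈F , e₂∈F , ∣e₁∩e₂∣≡k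
  to : EdgesMeetingIn k F → Any (λ e₁ → Any (λ e₂ → ∣ e₁ ∩ e₂ ∣ ≡ k) F) F
  to (e₁ , e₂ , e₁∈F , e₂∈F , ∣e₁∩e₂∣≡k) = lose e₁∈F (lose e₂∈F ∣e₁∩e₂∣≡k)

-- E has at most one vertex in E₀, and not exactly one.
disjoint-if-not-meeting-in-1 : ∀ {n} {E E₀ : Subset n} {d d′} → ∣ E ∣ ≡ 3 → d ∈ᵥ E → d′ ∈ᵥ E → d ≢ d′ →
  d ∉ᵥ E₀ → d′ ∉ᵥ E₀ → ∣ E ∩ E₀ ∣ ≢ 1 → ∀ {w} → w ∈ᵥ E → w ∉ᵥ E₀
disjoint-if-not-meeting-in-1 {E = E} {E₀} ∣E∣≡3 d∈E d′∈E d≢d′ d∉E₀ d′∉E₀ ∣E∩E₀∣≢1 w∈E w∈E₀ =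
  ℕP.m<n⇒n≢0 (x∈p⇒1≤∣p∣ (x∈p∩q⁺ (w∈E , w∈E₀))) (ℕP.n<1⇒n≡0 (ℕP.≤∧≢⇒< ∣E∩E₀∣≤1 ∣E∩E₀∣≢1))
  where
  2≤∣E-E₀∣ : 2 ℕ.≤ ∣ E ∩ ∁ E₀ ∣
  2≤∣E-E₀∣ = x,y∈p⇒2≤∣p∣ (x∈p∩q⁺ (d∈E , x∉p⇒x∈∁p d∉E₀)) (x∈p∩q⁺ (d′∈E , x∉p⇒x∈∁p d′∉E₀)) d≢d′
  ∣E∩E₀∣≤1 : ∣ E ∩ E₀ ∣ ℕ.≤ 1
  ∣E∩E₀∣≤1 = ℕP.+-cancelʳ-≤ 2 ∣ E ∩ E₀ ∣ 1
    (subst (∣ E ∩ E₀ ∣ ℕ.+ 2 ℕ.≤_) (trans (∣p∩q∣+∣p∩∁q∣≡∣p∣ E E₀) ∣E∣≡3) (ℕP.+-monoʳ-≤ ∣ E ∩ E₀ ∣ 2≤∣E-E₀∣))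

-- With E₀ ∋ 0, 1 and d, d′ ∉ E₀, the edges E₂ ∋ d, d′ and E₁ ∋ 0, d would force
-- |E₁| ≥ |E₁ ∩ E₀| + |E₁ ∩ E₂| ≥ 2 + 2, since E₂ misses E₀.
covering-3-graph-meets-in-1 : ∀ {n} {F : List (Subset n)} → 5 ℕ.≤ n → All (λ e → ∣ e ∣ ≡ 3) F →
  CoversPairs F → ¬ ¬ EdgesMeetingIn 1 F
covering-3-graph-meets-in-1 {zero}        ()
covering-3-graph-meets-in-1 {suc zero}    (ℕ.s≤s ())
covering-3-graph-meets-in-1 {suc (suc n)} {F} 5≤n sizes covers no-meeting
  with find (covers {zero} {suc zero} (λ ()))
... | E₀ , E₀∈F , 0∈E₀ , _
  with 2≤∣p∣⇒two-elements (m≤∣∁p∣ {p = E₀} (All.lookup sizes E₀∈F) 5≤n)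
... | d , d′ , d∈∁E₀ , d′∈∁E₀ , d≢d′
  with find (covers d≢d′) | find (covers {zero} {d} (λ 0≡d → x∈∁p⇒x∉p d∈∁E₀ (subst (_∈ᵥ E₀) 0≡d 0∈E₀)))
... | E₂ , E₂∈F , d∈E₂ , d′∈E₂ | E₁ , E₁∈F , 0∈E₁ , d∈E₁ =
  ℕP.<-irrefl refl (subst (4 ℕ.≤_) (All.lookup sizes E₁∈F)
    (ℕP.≤-trans 4≤∣E₁∩E₀∣+∣E₁∩E₂∣ (∣p∩q∣+∣p∩r∣≤∣p∣ E₁ E₂-misses-E₀)))
  where
  ∣∩∣≢1 : ∀ {e f} → e ∈ F → f ∈ F → ∣ e ∩ f ∣ ≢ 1
  ∣∩∣≢1 e∈F f∈F ∣e∩f∣≡1 = no-meeting (_ , _ , e∈F , f∈F , ∣e∩f∣≡1)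
  2≤∣∩∣ : ∀ {e f w} → e ∈ F → f ∈ F → w ∈ᵥ e → w ∈ᵥ f → 2 ℕ.≤ ∣ e ∩ f ∣
  2≤∣∩∣ e∈F f∈F w∈e w∈f = 1≤m∧m≢1⇒2≤m (x∈p⇒1≤∣p∣ (x∈p∩q⁺ (w∈e , w∈f))) (∣∩∣≢1 e∈F f∈F)
  E₂-misses-E₀ : ∀ {w} → w ∈ᵥ E₂ → w ∉ᵥ E₀
  E₂-misses-E₀ = disjoint-if-not-meeting-in-1 (All.lookup sizes E₂∈F) d∈E₂ d′∈E₂ d≢d′
    (x∈∁p⇒x∉p d∈∁E₀) (x∈∁p⇒x∉p d′∈∁E₀) (∣∩∣≢1 E₂∈F E₀∈F)
  4≤∣E₁∩E₀∣+∣E₁∩E₂∣ : 4 ℕ.≤ ∣ E₁ ∩ E₀ ∣ ℕ.+ ∣ E₁ ∩ E₂ ∣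
  4≤∣E₁∩E₀∣+∣E₁∩E₂∣ = ℕP.+-mono-≤ (2≤∣∩∣ E₁∈F E₀∈F 0∈E₁ 0∈E₀) (2≤∣∩∣ E₁∈F E₂∈F d∈E₁ d∈E₂)

distinct-3-sets-meet-in-≤1 : ∀ {n} {e f : Subset n} → ∣ e ∣ ≡ 3 → ∣ f ∣ ≡ 3 → e ≢ f → ∣ e ∩ f ∣ ≢ 2 →
  ∣ e ∩ f ∣ ℕ.≤ 1
distinct-3-sets-meet-in-≤1 {e = e} {f} ∣e∣≡3 ∣f∣≡3 e≢f ∣e∩f∣≢2 =
  ℕP.≤-pred (ℕP.≤∧≢⇒< (ℕP.≤-pred (ℕP.≤∧≢⇒< ∣e∩f∣≤3 ∣e∩f∣≢3)) ∣e∩f∣≢2)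
  where
  ∣e∩f∣≤3 : ∣ e ∩ f ∣ ℕ.≤ 3
  ∣e∩f∣≤3 = subst (∣ e ∩ f ∣ ℕ.≤_) ∣e∣≡3 (∣p∩q∣≤∣p∣ e f)
  ∣e∩f∣≢3 : ∣ e ∩ f ∣ ≢ 3
  ∣e∩f∣≢3 ∣e∩f∣≡3 = e≢f (⊆-antisym
    (∣p∩q∣≡∣p∣⇒p⊆q (trans ∣e∩f∣≡3 (sym ∣e∣≡3)))
    (∣p∩q∣≡∣p∣⇒p⊆q (trans (cong ∣_∣ (∩-comm f e)) (trans ∣e∩f∣≡3 (sym ∣f∣≡3)))))

no-meeting-in-2⇒linear : ∀ {n} {F : List (Subset n)} → Is3Graph F → ¬ EdgesMeetingIn 2 F → Linear F
no-meeting-in-2⇒linear {F = F} (unique , sizes) no-meeting = linear-sublist F (λ e∈F → e∈F) unique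
  where
  meet≤1 : ∀ {e f} → e ∈ F → f ∈ F → e ≢ f → ∣ e ∩ f ∣ ℕ.≤ 1
  meet≤1 e∈F f∈F e≢f = distinct-3-sets-meet-in-≤1 (All.lookup sizes e∈F) (All.lookup sizes f∈F) e≢f
    (λ ∣e∩f∣≡2 → no-meeting (_ , _ , e∈F , f∈F , ∣e∩f∣≡2))
  linear-sublist : ∀ G → (∀ {e} → e ∈ G → e ∈ F) → Unique G → Linear G
  linear-sublist []      G⊆F []               = []
  linear-sublist (e ∷ G) G⊆F (e∉G ∷ unique-G) =
    All.tabulate (λ f∈G → meet≤1 (G⊆F (here refl)) (G⊆F (there f∈G)) (All.lookup e∉G f∈G))
    ∷ linear-sublist G (G⊆F ∘ there) unique-G

single-edge-subgraph : ∀ {n} {F : List (Subset n)} {e} → e ∈ F → IsSubgraphOn (e ∷ []) e F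
single-edge-subgraph e∈F = ([] ∷ []) , ((e∈F , λ w∈e → w∈e) ∷ [])

-- The single edge E, weighted uniformly, already has Lagrangian 1/27, which a linear F cannot beat.
dense⇒¬linear : ∀ {n} {F : List (Subset n)} → 4 ℕ.≤ n → Is3Graph F → Dense F → ¬ Linear F
dense⇒¬linear {zero}        ()
dense⇒¬linear {suc zero}    (ℕ.s≤s ())
dense⇒¬linear {suc (suc n)} {F} 4≤n (unique , sizes) dense linear
  with find (dense⇒covers-pairs unique dense {zero} {suc zero} (λ ()))
... | E , E∈F , _
  with dense E (E ∷ []) (subst (ℕ._< suc (suc n)) (sym (All.lookup sizes E∈F)) 4≤n) (single-edge-subgraph E∈F)
... | x , x∈Δ , ε , 0<ε , gap = <-irrefl refl (begin-strict
  1ℚ                          <⟨ p<p+q (0<p*q (positive⁻¹ 27) 0<ε) ⟩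
  1ℚ + 27 * ε                 ≡⟨ trans (cong (λ t → 27 * (t + ε)) λ[E,u]≡1/27) (expand ε) ⟨
  27 * (lam (E ∷ []) u + ε)   ≤⟨ *-monoˡ-≤-0≤ (nonNegative⁻¹ 27) (gap u u∈Δ) ⟩
  27 * lam F x                ≤⟨ linear-lagrangian≤1/27 F x sizes linear x∈Δ ⟩
  1ℚ                          ∎)
  where
  open ≤-Reasoning
  ∣E∣≡3 : ∣ E ∣ ≡ 3
  ∣E∣≡3 = All.lookup sizes E∈F
  u : Fin (suc (suc n)) → ℚ
  u = restrict E (const (1/ 3))
  u∈Δ : InSimplex E u
  u∈Δ = restrict-nonNeg E (λ _ → ≤ᵇ⇒≤ tt) , (λ w w∉E → restrict-∉ {p = E} (const (1/ 3)) w∉E) ,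
        trans (sumF≡sum u) (trans (sym (sumOn≡∑restrict E (const (1/ 3))))
          (trans (sumOn-const E (1/ 3)) (cong (_· 1/ 3) ∣E∣≡3)))
  λ[E,u]≡1/27 : lam (E ∷ []) u ≡ 1/ 27
  λ[E,u]≡1/27 = cong (_+ 0ℚ) (trans (prodOn-cong E (restrict-∈ {p = E} (const (1/ 3))))
    (trans (prodOn-const E (1/ 3)) (cong ((1/ 3) ^_) ∣E∣≡3)))
  expand : ∀ ε → 27 * (1/ 27 + ε) ≡ 1ℚ + 27 * ε
  expand = solve-∀ ℚ-ring

mainTheorem3 : (i : ℕ) → (i ≡ 1 ⊎ i ≡ 2) → (n : ℕ) → 6 ℕ.∸ i ℕ.≤ n →
    (F : List (Subset n)) → Is3Graph F → Dense F →
    Σ (Subset n) λ e₁ → Σ (Subset n) λ e₂ → (e₁ ∈ F) × (e₂ ∈ F) × (∣ e₁ ∩ e₂ ∣ ≡ i)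
mainTheorem3 i (inj₁ refl) n 5≤n F (unique , sizes) dense =
  decidable-stable (edges-meeting-in? 1 F)
    (covering-3-graph-meets-in-1 5≤n sizes (dense⇒covers-pairs unique dense))
mainTheorem3 i (inj₂ refl) n 4≤n F is3Graph dense =
  decidable-stable (edges-meeting-in? 2 F)
    (dense⇒¬linear 4≤n is3Graph dense ∘ no-meeting-in-2⇒linear is3Graph)
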